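{- Let $m,n\in\mathbb{N}$ with $m\ge3$ and $n\ge m$, let $S_n$ be the symmetric group on $\{a_1,\dots,a_n\}$, and let $S_{n+(m-2)}$ be the symmetric group on $\{a_1,\dots,a_n\}\cup\{x_1,\dots,x_{m-2}\}$ (new points $x_j$). If $\tau\in S_n$ is a $3$-cycle, then there exist $\mu_1,\mu_2\in S_{n+(m-2)}\setminus S_n$ such that $\tau^{ -1}=\mu_1\mu_2$, each $\mu_i$ is an $m$-cycle, and $\mu_1,\mu_2$ move distinct sets of $m$ elements.
   Context: $S_{n+(m-2)}\setminus S_n$ consists of permutations moving at least one of $x_1,\dots,x_{m-2}$. Products are compositions, rightmost applied first. -}

module Defs where

open import Data.Nat using (ℕ; zero; suc; _+_; _∸_; _<?_; s≤s)
open import Data.Fin using (Fin; zero; toℕ; fromℕ<; _↑ʳ_)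
open import Data.Fin.Permutation using (Permutation′; _⟨$⟩ʳ_)
open import Data.Product using (Σ; ∃; _×_)
open import Relation.Binary.PropositionalEquality using (_≡_; _≢_)
open import Relation.Nullary using (¬_; yes; no)
open import Function.Definitions using (Injective)

succMod : ∀ {k} → Fin k → Fin k
succMod {suc k} i with suc (toℕ i) <? suc k
... | yes p = fromℕ< p
... | no _  = zero

Moves : ∀ {N} → Permutation′ N → Fin N → Set
Moves σ y = σ ⟨$⟩ʳ y ≢ y

IsCycle : ∀ {N} → ℕ → Permutation′ N → Set
IsCycle {N} k σ =
  Σ (Fin k → Fin N) λ c →
    Injective _≡_ _≡_ c
    × (∀ i → σ ⟨$⟩ʳ c i ≡ c (succMod i))
    × (∀ y → (∀ i → c i ≢ y) → σ ⟨$⟩ʳ y ≡ y)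

-- The ground set {a_1..a_n} ∪ {x_1..x_{m-2}} is Fin (n + (m ∸ 2)):
-- a_i ↦ i ↑ˡ (m ∸ 2), x_j ↦ n ↑ʳ j.
-- S_n sits inside as the permutations fixing every x_j.
InSn : ∀ n m → Permutation′ (n + (m ∸ 2)) → Set
InSn n m σ = ∀ (j : Fin (m ∸ 2)) → σ ⟨$⟩ʳ (n ↑ʳ j) ≡ n ↑ʳ j

-- Write τ = (a b c) and x₀, …, x_k (k = m − 3) for the new points.  Then
--   τ⁻¹ = (a c b) = (c b x_k … x₀) ∘ (b a x₀ … x_k),
-- a product of two m-cycles that both move the new points, and only the right
-- one moves a.
module Submission where

open import Defs
open import Data.Nat using (ℕ; _+_; _∸_; _≤_; _<_; zero; suc; s≤s; _<?_)
open import Data.Nat.Properties using (<-irrefl)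
open import Data.Fin using (Fin; zero; suc; toℕ; fromℕ; inject₁; opposite; _↑ʳ_; _≟_)
open import Data.Fin.Properties
  using (toℕ-injective; toℕ-fromℕ<; toℕ-fromℕ; toℕ-inject₁; toℕ<n; any?; ↑ʳ-injective; opposite-involutive)
open import Data.Fin.Permutation
  using (Permutation′; _⟨$⟩ʳ_; _⟨$⟩ˡ_; permutation; inverseˡ; inverseʳ)
open import Data.Product using (Σ; ∃; _×_; _,_)
open import Relation.Binary.PropositionalEquality
  using (_≡_; _≢_; refl; sym; trans; cong; subst; module ≡-Reasoning)
open import Relation.Nullary using (¬_; Dec; yes; no; contradiction)
open import Function.Base using (_∘_)
open import Function.Bundles using (_⇔_; Equivalence; Inverse)
open import Function.Definitions using (Injective)

data LastOrInject₁ : ∀ {K} → Fin (suc K) → Set where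
  last   : ∀ {K} → LastOrInject₁ (fromℕ K)
  inject : ∀ {K} (j : Fin K) → LastOrInject₁ (inject₁ j)

lastOrInject₁ : ∀ {K} (i : Fin (suc K)) → LastOrInject₁ i
lastOrInject₁ {zero}  zero    = last
lastOrInject₁ {suc K} zero    = inject zero
lastOrInject₁ {suc K} (suc i) with lastOrInject₁ i
... | last     = last
... | inject j = inject (suc j)

succMod-fromℕ : ∀ K → succMod (fromℕ K) ≡ zero
succMod-fromℕ K with suc (toℕ (fromℕ K)) <? suc K
... | yes p = contradiction (subst (λ t → suc t < suc K) (toℕ-fromℕ K) p) (<-irrefl refl)
... | no _  = refl

succMod-inject₁ : ∀ {K} (j : Fin K) → succMod (inject₁ j) ≡ suc j
succMod-inject₁ {K} j with suc (toℕ (inject₁ j)) <? suc K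
... | yes p = toℕ-injective (trans (toℕ-fromℕ< p) (cong suc (toℕ-inject₁ j)))
... | no ¬p = contradiction (s≤s (subst (_< K) (sym (toℕ-inject₁ j)) (toℕ<n j))) ¬p

predMod : ∀ {K} → Fin (suc K) → Fin (suc K)
predMod zero    = fromℕ _
predMod (suc i) = inject₁ i

succMod-predMod : ∀ {K} (i : Fin (suc K)) → succMod (predMod i) ≡ i
succMod-predMod {K} zero = succMod-fromℕ K
succMod-predMod (suc i)  = succMod-inject₁ i

predMod-succMod : ∀ {K} (i : Fin (suc K)) → predMod (succMod i) ≡ i
predMod-succMod i with lastOrInject₁ i
... | last {K}  = cong predMod (succMod-fromℕ K)
... | inject j  = cong predMod (succMod-inject₁ j)

rotation : ∀ K → Permutation′ (suc K)
rotation K = permutation succMod predMod succMod-predMod predMod-succMod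

module _ {k N : ℕ} {d : Fin k → Fin N} (d-injective : Injective _≡_ _≡_ d) where

  relabel : (Fin k → Fin k) → Fin N → Fin N
  relabel f y with any? (λ i → d i ≟ y)
  ... | yes (i , _) = d (f i)
  ... | no _        = y

  relabel-image : ∀ f i → relabel f (d i) ≡ d (f i)
  relabel-image f i with any? (λ i′ → d i′ ≟ d i)
  ... | yes (i′ , di′≡di) = cong (λ j → d (f j)) (d-injective di′≡di)
  ... | no ∄i             = contradiction (i , refl) ∄i

  relabel-outside : ∀ f y → (∀ i → d i ≢ y) → relabel f y ≡ y
  relabel-outside f y y∉d with any? (λ i → d i ≟ y)
  ... | yes (i , di≡y) = contradiction di≡y (y∉d i)
  ... | no _           = refl

  relabel-inverse : ∀ f g → (∀ i → f (g i) ≡ i) → ∀ y → relabel f (relabel g y) ≡ y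
  relabel-inverse f g f∘g≗id y = by-cases (any? (λ i → d i ≟ y))
    where
    by-cases : Dec (∃ λ i → d i ≡ y) → relabel f (relabel g y) ≡ y
    by-cases (yes (i , refl)) =
      trans (cong (relabel f) (relabel-image g i)) (trans (relabel-image f (g i)) (cong d (f∘g≗id i)))
    by-cases (no ∄i) =
      trans (cong (relabel f) (relabel-outside g y y∉d)) (relabel-outside f y y∉d)
      where y∉d : ∀ i → d i ≢ y
            y∉d i di≡y = ∄i (i , di≡y)

  extendAlong : Permutation′ k → Permutation′ N
  extendAlong π = permutation (relabel (π ⟨$⟩ʳ_)) (relabel (π ⟨$⟩ˡ_))
    (relabel-inverse _ _ (λ _ → inverseʳ π)) (relabel-inverse _ _ (λ _ → inverseˡ π))

module _ {K N : ℕ} {d : Fin (suc K) → Fin N} (d-injective : Injective _≡_ _≡_ d) where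

  cycle : Permutation′ N
  cycle = extendAlong d-injective (rotation K)

  cycle-step : ∀ i → cycle ⟨$⟩ʳ d i ≡ d (succMod i)
  cycle-step = relabel-image d-injective succMod

  cycle-last : cycle ⟨$⟩ʳ d (fromℕ K) ≡ d zero
  cycle-last = trans (cycle-step (fromℕ K)) (cong d (succMod-fromℕ K))

  cycle-inject₁ : ∀ j → cycle ⟨$⟩ʳ d (inject₁ j) ≡ d (suc j)
  cycle-inject₁ j = trans (cycle-step (inject₁ j)) (cong d (succMod-inject₁ j))

  cycle-outside : ∀ y → (∀ i → d i ≢ y) → cycle ⟨$⟩ʳ y ≡ y
  cycle-outside = relabel-outside d-injective succMod

  cycle-isCycle : IsCycle (suc K) cycle
  cycle-isCycle = d , d-injective , cycle-step , cycle-outside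

module InverseOfThreeCycle {n k : ℕ} (τ : Permutation′ (n + suc k))
  (τ-fixes-x : ∀ j → τ ⟨$⟩ʳ (n ↑ʳ j) ≡ n ↑ʳ j)
  (e : Fin 3 → Fin (n + suc k)) (e-injective : Injective _≡_ _≡_ e)
  (τ-step : ∀ i → τ ⟨$⟩ʳ e i ≡ e (succMod i))
  (τ-outside : ∀ y → (∀ i → e i ≢ y) → τ ⟨$⟩ʳ y ≡ y) where

  x : Fin (suc k) → Fin (n + suc k)
  x j = n ↑ʳ j

  a b c : Fin (n + suc k)
  a = e zero
  b = e (suc zero)
  c = e (suc (suc zero))

  τa : τ ⟨$⟩ʳ a ≡ b
  τa = τ-step zero

  τb : τ ⟨$⟩ʳ b ≡ c
  τb = τ-step (suc zero)

  τc : τ ⟨$⟩ʳ c ≡ a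
  τc = τ-step (suc (suc zero))

  a≢b : a ≢ b
  a≢b a≡b with () ← e-injective a≡b

  a≢c : a ≢ c
  a≢c a≡c with () ← e-injective a≡c

  b≢c : b ≢ c
  b≢c b≡c with () ← e-injective b≡c

  x≢moved : ∀ j {y} → τ ⟨$⟩ʳ y ≢ y → x j ≢ y
  x≢moved j τy≢y refl = τy≢y (τ-fixes-x j)

  x≢a : ∀ j → x j ≢ a
  x≢a j = x≢moved j λ τa≡a → a≢b (trans (sym τa≡a) τa)

  x≢b : ∀ j → x j ≢ b
  x≢b j = x≢moved j λ τb≡b → b≢c (trans (sym τb≡b) τb)

  x≢c : ∀ j → x j ≢ c
  x≢c j = x≢moved j λ τc≡c → a≢c (trans (sym τc) τc≡c)

  d₂ : Fin (3 + k) → Fin (n + suc k)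
  d₂ zero             = b
  d₂ (suc zero)       = a
  d₂ (suc (suc j))    = x j

  d₁ : Fin (3 + k) → Fin (n + suc k)
  d₁ zero             = c
  d₁ (suc zero)       = b
  d₁ (suc (suc j))    = x (opposite j)

  x-injective : Injective _≡_ _≡_ x
  x-injective = ↑ʳ-injective n _ _

  d₂-injective : Injective _≡_ _≡_ d₂
  d₂-injective {zero}        {zero}        _  = refl
  d₂-injective {zero}        {suc zero}    eq = contradiction (sym eq) a≢b
  d₂-injective {zero}        {suc (suc j)} eq = contradiction (sym eq) (x≢b j)
  d₂-injective {suc zero}    {zero}        eq = contradiction eq a≢b
  d₂-injective {suc zero}    {suc zero}    _  = refl
  d₂-injective {suc zero}    {suc (suc j)} eq = contradiction (sym eq) (x≢a j)
  d₂-injective {suc (suc i)} {zero}        eq = contradiction eq (x≢b i)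
  d₂-injective {suc (suc i)} {suc zero}    eq = contradiction eq (x≢a i)
  d₂-injective {suc (suc i)} {suc (suc j)} eq = cong (λ l → suc (suc l)) (x-injective eq)

  d₁-injective : Injective _≡_ _≡_ d₁
  d₁-injective {zero}        {zero}        _  = refl
  d₁-injective {zero}        {suc zero}    eq = contradiction (sym eq) b≢c
  d₁-injective {zero}        {suc (suc j)} eq = contradiction (sym eq) (x≢c _)
  d₁-injective {suc zero}    {zero}        eq = contradiction eq b≢c
  d₁-injective {suc zero}    {suc zero}    _  = refl
  d₁-injective {suc zero}    {suc (suc j)} eq = contradiction (sym eq) (x≢b _)
  d₁-injective {suc (suc i)} {zero}        eq = contradiction eq (x≢c _)
  d₁-injective {suc (suc i)} {suc zero}    eq = contradiction eq (x≢b _)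
  d₁-injective {suc (suc i)} {suc (suc j)} eq = cong (λ l → suc (suc l)) (opposite-injective (x-injective eq))
    where opposite-injective : ∀ {i j : Fin (suc k)} → opposite i ≡ opposite j → i ≡ j
          opposite-injective {i} {j} eq′ =
            trans (sym (opposite-involutive i)) (trans (cong opposite eq′) (opposite-involutive j))

  μ₁ μ₂ : Permutation′ (n + suc k)
  μ₁ = cycle d₁-injective
  μ₂ = cycle d₂-injective

  μ₂b : μ₂ ⟨$⟩ʳ b ≡ a
  μ₂b = cycle-inject₁ d₂-injective zero

  μ₂a : μ₂ ⟨$⟩ʳ a ≡ x zero
  μ₂a = cycle-inject₁ d₂-injective (suc zero)

  μ₂x-inject₁ : ∀ j → μ₂ ⟨$⟩ʳ x (inject₁ j) ≡ x (suc j)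
  μ₂x-inject₁ j = cycle-inject₁ d₂-injective (suc (suc j))

  μ₂x-last : μ₂ ⟨$⟩ʳ x (fromℕ k) ≡ b
  μ₂x-last = cycle-last d₂-injective

  μ₂c : μ₂ ⟨$⟩ʳ c ≡ c
  μ₂c = cycle-outside d₂-injective c λ
    { zero b≡c → b≢c b≡c ; (suc zero) a≡c → a≢c a≡c ; (suc (suc j)) → x≢c j }

  μ₁c : μ₁ ⟨$⟩ʳ c ≡ b
  μ₁c = cycle-inject₁ d₁-injective zero

  μ₁b : μ₁ ⟨$⟩ʳ b ≡ x (fromℕ k)
  μ₁b = cycle-inject₁ d₁-injective (suc zero)

  μ₁a : μ₁ ⟨$⟩ʳ a ≡ a
  μ₁a = cycle-outside d₁-injective a λ
    { zero c≡a → a≢c (sym c≡a) ; (suc zero) b≡a → a≢b (sym b≡a) ; (suc (suc j)) → x≢a _ }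

  x≡d₁ : ∀ j → x j ≡ d₁ (suc (suc (opposite j)))
  x≡d₁ j = cong x (sym (opposite-involutive j))

  μ₁x-zero : μ₁ ⟨$⟩ʳ x zero ≡ c
  μ₁x-zero = trans (cong (μ₁ ⟨$⟩ʳ_) (x≡d₁ zero)) (cycle-last d₁-injective)

  μ₁x-suc : ∀ j → μ₁ ⟨$⟩ʳ x (suc j) ≡ x (inject₁ j)
  μ₁x-suc j = begin
    μ₁ ⟨$⟩ʳ x (suc j)                              ≡⟨ cong (μ₁ ⟨$⟩ʳ_) (x≡d₁ (suc j)) ⟩
    μ₁ ⟨$⟩ʳ d₁ (inject₁ (suc (suc (opposite j)))) ≡⟨ cycle-inject₁ d₁-injective (suc (suc (opposite j))) ⟩
    x (inject₁ (opposite (opposite j)))            ≡⟨ cong (x ∘ inject₁) (opposite-involutive j) ⟩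
    x (inject₁ j)                                  ∎
    where open ≡-Reasoning

  τ∘μ₁∘μ₂≗id : ∀ y → τ ⟨$⟩ʳ (μ₁ ⟨$⟩ʳ (μ₂ ⟨$⟩ʳ y)) ≡ y
  τ∘μ₁∘μ₂≗id y = by-cases (any? (λ i → d₂ i ≟ y)) (y ≟ c)
    where
    open ≡-Reasoning
    by-cases : Dec (∃ λ i → d₂ i ≡ y) → Dec (y ≡ c) → τ ⟨$⟩ʳ (μ₁ ⟨$⟩ʳ (μ₂ ⟨$⟩ʳ y)) ≡ y
    by-cases (yes (zero , refl)) _ = begin
      τ ⟨$⟩ʳ (μ₁ ⟨$⟩ʳ (μ₂ ⟨$⟩ʳ b)) ≡⟨ cong (λ z → τ ⟨$⟩ʳ (μ₁ ⟨$⟩ʳ z)) μ₂b ⟩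
      τ ⟨$⟩ʳ (μ₁ ⟨$⟩ʳ a)           ≡⟨ cong (τ ⟨$⟩ʳ_) μ₁a ⟩
      τ ⟨$⟩ʳ a                     ≡⟨ τa ⟩
      b                            ∎
    by-cases (yes (suc zero , refl)) _ = begin
      τ ⟨$⟩ʳ (μ₁ ⟨$⟩ʳ (μ₂ ⟨$⟩ʳ a)) ≡⟨ cong (λ z → τ ⟨$⟩ʳ (μ₁ ⟨$⟩ʳ z)) μ₂a ⟩
      τ ⟨$⟩ʳ (μ₁ ⟨$⟩ʳ x zero)      ≡⟨ cong (τ ⟨$⟩ʳ_) μ₁x-zero ⟩
      τ ⟨$⟩ʳ c                     ≡⟨ τc ⟩
      a                            ∎
    by-cases (yes (suc (suc j) , refl)) _ with lastOrInject₁ j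
    ... | last = begin
      τ ⟨$⟩ʳ (μ₁ ⟨$⟩ʳ (μ₂ ⟨$⟩ʳ x (fromℕ k))) ≡⟨ cong (λ z → τ ⟨$⟩ʳ (μ₁ ⟨$⟩ʳ z)) μ₂x-last ⟩
      τ ⟨$⟩ʳ (μ₁ ⟨$⟩ʳ b)                     ≡⟨ cong (τ ⟨$⟩ʳ_) μ₁b ⟩
      τ ⟨$⟩ʳ x (fromℕ k)                     ≡⟨ τ-fixes-x (fromℕ k) ⟩
      x (fromℕ k)                            ∎
    ... | inject i = begin
      τ ⟨$⟩ʳ (μ₁ ⟨$⟩ʳ (μ₂ ⟨$⟩ʳ x (inject₁ i))) ≡⟨ cong (λ z → τ ⟨$⟩ʳ (μ₁ ⟨$⟩ʳ z)) (μ₂x-inject₁ i) ⟩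
      τ ⟨$⟩ʳ (μ₁ ⟨$⟩ʳ x (suc i))               ≡⟨ cong (τ ⟨$⟩ʳ_) (μ₁x-suc i) ⟩
      τ ⟨$⟩ʳ x (inject₁ i)                     ≡⟨ τ-fixes-x (inject₁ i) ⟩
      x (inject₁ i)                            ∎
    by-cases (no _) (yes refl) = begin
      τ ⟨$⟩ʳ (μ₁ ⟨$⟩ʳ (μ₂ ⟨$⟩ʳ c)) ≡⟨ cong (λ z → τ ⟨$⟩ʳ (μ₁ ⟨$⟩ʳ z)) μ₂c ⟩
      τ ⟨$⟩ʳ (μ₁ ⟨$⟩ʳ c)           ≡⟨ cong (τ ⟨$⟩ʳ_) μ₁c ⟩
      τ ⟨$⟩ʳ b                     ≡⟨ τb ⟩
      c                            ∎
    by-cases (no y∉d₂) (no y≢c) = begin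
      τ ⟨$⟩ʳ (μ₁ ⟨$⟩ʳ (μ₂ ⟨$⟩ʳ y)) ≡⟨ cong (λ z → τ ⟨$⟩ʳ (μ₁ ⟨$⟩ʳ z)) (cycle-outside d₂-injective y y∉im-d₂) ⟩
      τ ⟨$⟩ʳ (μ₁ ⟨$⟩ʳ y)           ≡⟨ cong (τ ⟨$⟩ʳ_) (cycle-outside d₁-injective y y∉im-d₁) ⟩
      τ ⟨$⟩ʳ y                     ≡⟨ τ-outside y y∉im-e ⟩
      y                            ∎
      where
      y∉im-d₂ : ∀ i → d₂ i ≢ y
      y∉im-d₂ i d₂i≡y = y∉d₂ (i , d₂i≡y)
      y∉im-d₁ : ∀ i → d₁ i ≢ y
      y∉im-d₁ zero          = y≢c ∘ sym
      y∉im-d₁ (suc zero)    = y∉im-d₂ zero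
      y∉im-d₁ (suc (suc i)) = y∉im-d₂ (suc (suc (opposite i)))
      y∉im-e : ∀ i → e i ≢ y
      y∉im-e zero                = y∉im-d₂ (suc zero)
      y∉im-e (suc zero)          = y∉im-d₂ zero
      y∉im-e (suc (suc zero))    = y∉im-d₁ zero

  τ⁻¹≗μ₁∘μ₂ : ∀ y → τ ⟨$⟩ˡ y ≡ μ₁ ⟨$⟩ʳ (μ₂ ⟨$⟩ʳ y)
  τ⁻¹≗μ₁∘μ₂ y = Inverse.inverseʳ τ (sym (τ∘μ₁∘μ₂≗id y))

  μ₁-moves-x : ¬ (∀ j → μ₁ ⟨$⟩ʳ x j ≡ x j)
  μ₁-moves-x fixes = x≢c zero (trans (sym (fixes zero)) μ₁x-zero)

  μ₂-moves-x : ¬ (∀ j → μ₂ ⟨$⟩ʳ x j ≡ x j)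
  μ₂-moves-x fixes = x≢b (fromℕ k) (trans (sym (fixes (fromℕ k))) μ₂x-last)

  supports-differ : ¬ (∀ y → Moves μ₁ y ⇔ Moves μ₂ y)
  supports-differ same = Equivalence.from (same a) μ₂-moves-a μ₁a
    where μ₂-moves-a : Moves μ₂ a
          μ₂-moves-a μ₂a≡a = x≢a zero (trans (sym μ₂a) μ₂a≡a)

mainTheorem6 : (m n : ℕ) → 3 ≤ m → m ≤ n →
    (τ : Permutation′ (n + (m ∸ 2))) → InSn n m τ → IsCycle 3 τ →
    Σ (Permutation′ (n + (m ∸ 2))) λ μ₁ → Σ (Permutation′ (n + (m ∸ 2))) λ μ₂ →
      ¬ InSn n m μ₁ × ¬ InSn n m μ₂
      × (∀ y → τ ⟨$⟩ˡ y ≡ μ₁ ⟨$⟩ʳ (μ₂ ⟨$⟩ʳ y))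
      × IsCycle m μ₁ × IsCycle m μ₂
      × ¬ (∀ y → Moves μ₁ y ⇔ Moves μ₂ y)
mainTheorem6 (suc (suc (suc k))) n (s≤s (s≤s (s≤s _))) _ τ τ∈Sn (e , e-injective , τ-step , τ-outside) =
  μ₁ , μ₂ , μ₁-moves-x , μ₂-moves-x , τ⁻¹≗μ₁∘μ₂
  , cycle-isCycle d₁-injective , cycle-isCycle d₂-injective , supports-differ
  where open InverseOfThreeCycle τ τ∈Sn e e-injective τ-step τ-outside
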